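{- The following are derivable for variables $a,b$: $(a=b)\Rightarrow(\mathrm{Sing}(a)=\mathrm{Sing}(b))$; $\neg\,\mathrm{Sing}(\varnothing)$; $\neg\,\mathrm{Sing}(\bot)$.
   Context: Formal system. Objects are generated from the constant $\varnothing$ by: $(\alpha)^{\mathsf c}$, $(\alpha)^{\mathsf v}$ (variables are objects of this form), $(\alpha\,\&\,\beta)$, $(\alpha\Rightarrow\beta)$, $(\alpha\cap\beta)$, and classes $\{x\mid\beta\}$ ($x$ a variable, which becomes a bound index). $\alpha[x:=\beta]$ replaces every free appearance of $x$ by $\beta$. Abbreviations: $\bot:=\varnothing^{\mathsf c}$; $\neg a:=(a\Rightarrow\bot)$; $\bar a:=(\varnothing\Rightarrow a)$; $a\vee b:=\overline{\bar a\cap\bar b}$; $a=b:=(a\Rightarrow b)\&(b\Rightarrow a)$; $a\neq b:=\neg(a=b)$; $\mathrm{Sing}(a):=(\bar a\neq a)\,\&\,((a\Rightarrow b)\Rightarrow(\bar b\vee a=b))$, with $b$ a variable ("$a$ is single"). Rules: R1 from $\alpha$ and $\alpha\Rightarrow\beta$ infer $\beta$; R2 from $\alpha$ infer $\alpha[x:=\beta]$; R3 if $x$ does not appear in $\gamma$, from $\gamma\Rightarrow(\alpha\Rightarrow\beta)$ infer $\gamma\Rightarrow(\{x\mid\beta\}\Rightarrow\{x\mid\alpha\})$. Axioms ($a,b,c,d,x$ variables): A1 $((c\Rightarrow a)\&(c\Rightarrow(a\Rightarrow b)))\Rightarrow(c\Rightarrow b)$; A2 $((d\Rightarrow(a\Rightarrow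 b))\&(d\Rightarrow(b\Rightarrow c)))\Rightarrow(d\Rightarrow(a\Rightarrow c))$; A3 $((c\Rightarrow a)\&(c\Rightarrow b))\Rightarrow(c\Rightarrow(a\&b))$; A4 $(a\&b)\Rightarrow a$, $(a\&b)\Rightarrow b$; A5 $a\Rightarrow(a\cap b)$, $b\Rightarrow(a\cap b)$; A6 $((a\Rightarrow c)\&(b\Rightarrow c))\Rightarrow((a\cap b)\Rightarrow c)$; A7 $a\Rightarrow a$; A8 $a\Rightarrow\varnothing$; A9 $\bot\Rightarrow a$; A10 $(\varnothing\Rightarrow a)\Rightarrow((\varnothing\Rightarrow b)\Rightarrow(a\&b))$; A11 $(a\Rightarrow b)\Rightarrow(\varnothing\Rightarrow(a\Rightarrow b))$; A12 $(((a\Rightarrow b)\Rightarrow\bot)\Rightarrow\bot)\Rightarrow(a\Rightarrow b)$; with $a\in b:=\mathrm{Sing}(a)\&(b\Rightarrow a)$ and $V:=\{x\mid\varnothing\}$: A13 (schema) $a\in\{x\mid\alpha\}=(\mathrm{Sing}(a)\&\alpha[x:=a])$; A14a $a\Rightarrow\{x\mid x\in a\}$; A14b $(V\Rightarrow a)\Rightarrow(\{x\mid x\in a\}\Rightarrow a)$. -}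

module Defs where

open import Data.Nat using (ℕ; zero; suc)
open import Data.Fin using (Fin; zero; suc)
open import Data.Bool using (Bool; true; false; _∧_; _∨_; if_then_else_)
open import Data.Product using (_×_)
open import Relation.Binary.PropositionalEquality using (_≡_)

-- Syntax (locally nameless).  Tm n = objects with n bound indices in
-- scope; Obj = Tm 0 are the objects of the system.
--   var s   is the variable (s)ᵛ  (s an object; variables are atomic)
--   cls B   is a class whose body B uses bound index 0

infixr 4 _⇒_
infixr 5 _&_
infixr 6 _∩_

data Tm (n : ℕ) : Set where
  ∅    : Tm n
  ix   : Fin n → Tm n
  var  : Tm 0 → Tm n
  _ᶜ   : Tm n → Tm n
  _&_  : Tm n → Tm n → Tm n
  _⇒_  : Tm n → Tm n → Tm n
  _∩_  : Tm n → Tm n → Tm n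
  cls  : Tm (suc n) → Tm n

Obj : Set
Obj = Tm 0

eqFin : ∀ {n} → Fin n → Fin n → Bool
eqFin zero    zero    = true
eqFin (suc i) (suc j) = eqFin i j
eqFin _       _       = false

eqTm : ∀ {n} → Tm n → Tm n → Bool
eqTm ∅         ∅         = true
eqTm (ix i)    (ix j)    = eqFin i j
eqTm (var s)   (var t)   = eqTm s t
eqTm (s ᶜ)     (t ᶜ)     = eqTm s t
eqTm (s & s')  (t & t')  = eqTm s t ∧ eqTm s' t'
eqTm (s ⇒ s')  (t ⇒ t')  = eqTm s t ∧ eqTm s' t'
eqTm (s ∩ s')  (t ∩ t')  = eqTm s t ∧ eqTm s' t'
eqTm (cls s)   (cls t)   = eqTm s t
eqTm _         _         = false

lift : ∀ {m n} → (Fin m → Fin n) → Fin (suc m) → Fin (suc n)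
lift ρ zero    = zero
lift ρ (suc i) = suc (ρ i)

rename : ∀ {m n} → (Fin m → Fin n) → Tm m → Tm n
rename ρ ∅         = ∅
rename ρ (ix i)    = ix (ρ i)
rename ρ (var s)   = var s
rename ρ (t ᶜ)     = rename ρ t ᶜ
rename ρ (t & u)   = rename ρ t & rename ρ u
rename ρ (t ⇒ u)   = rename ρ t ⇒ rename ρ u
rename ρ (t ∩ u)   = rename ρ t ∩ rename ρ u
rename ρ (cls t)   = cls (rename (lift ρ) t)

wk : ∀ {n} → Tm n → Tm (suc n)
wk = rename suc

emb : ∀ {n} → Obj → Tm n
emb = rename (λ ())

replace : ∀ {n} → Obj → Tm n → Tm n → Tm n
replace x u ∅         = ∅
replace x u (ix i)    = ix i
replace x u (var s)   = if eqTm s x then u else var s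
replace x u (t ᶜ)     = replace x u t ᶜ
replace x u (t & t')  = replace x u t & replace x u t'
replace x u (t ⇒ t')  = replace x u t ⇒ replace x u t'
replace x u (t ∩ t')  = replace x u t ∩ replace x u t'
replace x u (cls t)   = cls (replace x (wk u) t)

_[_≔_] : Obj → Obj → Obj → Obj
α [ x ≔ β ] = replace x β α

-- the class {(x)ᵛ | β}: the variable becomes bound index 0
Cls : Obj → Obj → Obj
Cls x β = cls (replace x (ix zero) (wk β))

occurs : ∀ {n} → Obj → Tm n → Bool
occurs x ∅         = false
occurs x (ix i)    = false
occurs x (var s)   = eqTm s x
occurs x (t ᶜ)     = occurs x t
occurs x (t & u)   = occurs x t ∨ occurs x u
occurs x (t ⇒ u)   = occurs x t ∨ occurs x u
occurs x (t ∩ u)   = occurs x t ∨ occurs x u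
occurs x (cls t)   = occurs x t

nm : ℕ → Obj
nm zero    = ∅
nm (suc k) = var (nm k)

𝕧 : ℕ → Obj
𝕧 k = var (nm k)

-- names (inner objects) of the axiom variables a,b,c,d,x, and of the
-- reserved auxiliary variable used inside Sing
na nb nc nd nx nSing : Obj
na = nm 0
nb = nm 1
nc = nm 2
nd = nm 3
nx = nm 4
nSing = nm 5

a b c d x : Obj
a = var na
b = var nb
c = var nc
d = var nd
x = var nx

bot : Obj
bot = ∅ ᶜ

neg : Obj → Obj
neg t = t ⇒ bot

bar : Obj → Obj
bar t = ∅ ⇒ t

_∨ₒ_ : Obj → Obj → Obj
s ∨ₒ t = bar (bar s ∩ bar t)

_≐_ : Obj → Obj → Obj
s ≐ t = (s ⇒ t) & (t ⇒ s)

_≠ₒ_ : Obj → Obj → Obj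
s ≠ₒ t = neg (s ≐ t)

Sing : Obj → Obj
Sing t = (bar t ≠ₒ t) & ((t ⇒ y) ⇒ (bar y ∨ₒ (t ≐ y)))
  where y = var nSing

_∈ₒ_ : Obj → Obj → Obj
s ∈ₒ t = Sing s & (t ⇒ s)

V : Obj
V = Cls nx ∅

infix 1 ⊢_

data ⊢_ : Obj → Set where
  R1   : ∀ {α β} → ⊢ α → ⊢ (α ⇒ β) → ⊢ β
  R2   : ∀ {α} (s β : Obj) → ⊢ α → ⊢ (α [ s ≔ β ])
  R3   : ∀ {γ α β} (s : Obj) → occurs s γ ≡ false →
         ⊢ (γ ⇒ (α ⇒ β)) → ⊢ (γ ⇒ (Cls s β ⇒ Cls s α))
  A1   : ⊢ ((c ⇒ a) & (c ⇒ (a ⇒ b))) ⇒ (c ⇒ b)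
  A2   : ⊢ ((d ⇒ (a ⇒ b)) & (d ⇒ (b ⇒ c))) ⇒ (d ⇒ (a ⇒ c))
  A3   : ⊢ ((c ⇒ a) & (c ⇒ b)) ⇒ (c ⇒ (a & b))
  A4l  : ⊢ (a & b) ⇒ a
  A4r  : ⊢ (a & b) ⇒ b
  A5l  : ⊢ a ⇒ (a ∩ b)
  A5r  : ⊢ b ⇒ (a ∩ b)
  A6   : ⊢ ((a ⇒ c) & (b ⇒ c)) ⇒ ((a ∩ b) ⇒ c)
  A7   : ⊢ a ⇒ a
  A8   : ⊢ a ⇒ ∅
  A9   : ⊢ bot ⇒ a
  A10  : ⊢ (∅ ⇒ a) ⇒ ((∅ ⇒ b) ⇒ (a & b))
  A11  : ⊢ (a ⇒ b) ⇒ (∅ ⇒ (a ⇒ b))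
  A12  : ⊢ (((a ⇒ b) ⇒ bot) ⇒ bot) ⇒ (a ⇒ b)
  A13  : (s α : Obj) → ⊢ (a ∈ₒ Cls s α) ≐ (Sing a & (α [ s ≔ a ]))
  A14a : ⊢ a ⇒ Cls nx (x ∈ₒ a)
  A14b : ⊢ (V ⇒ a) ⇒ (Cls nx (x ∈ₒ a) ⇒ a)

module Submission where

-- R2 replaces one variable at a time, so an axiom is
--    instantiated simultaneously in two passes: first its variables a,b,c,d
--    are renamed to fresh "guard" variables, then each guard is replaced by
--    the desired object.  Guards are variables named by towers ∅ᶜ⋯ᶜ that are
--    taller than every complement tower occurring in the objects involved,
--    so no replacement disturbs what an earlier one inserted.
-- 2. Derived rules.  Since ∅ is a theorem and ∅ ⇒ X behaves as a necessity
--    modality (A10, A11), the axioms A1-A6 yield rules under a hypothesis.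
--    Implications, and conjunctions of them, are "persistent"; for a
--    persistent hypothesis a deduction theorem holds.
-- 3. Congruence.  Under a persistent hypothesis making A and B equivalent,
--    every context built from constants by &, ⇒ and ∩ maps A and B to
--    equivalent objects.  Sing(t) is such a context in t: part one.
-- 4. An object implying its own necessitation is not single: since always
--    ∅ ⇒ t implies t, the first conjunct of Sing(t) is refuted.  Both ∅ and
--    ⊥ imply their necessitations, giving parts two and three.

open import Defs
open import Data.Bool using (true; false)
open import Data.Nat using (ℕ; zero; suc; _+_; _⊔_; _<_; z<s; s<s; s<s⁻¹)
open import Data.Nat.Properties using (n<1+n; <-trans; m⊔n<o⇒m<o; m⊔n<o⇒n<o; m≤n+m; +-monoˡ-<)
open import Data.Product using (_×_; _,_)
open import Relation.Binary.PropositionalEquality using (_≡_; refl; cong; cong₂; subst; sym)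

-- Objects built from the metavariables a, b, c, d by ∅, &, ⇒ and ∩; the
-- axioms A1-A6, A10, A11 are of this shape.
infixr 4 _⇒ₛ_
infixr 5 _&ₛ_
infixr 6 _∩ₛ_

data Schema : Set where
  aₛ bₛ cₛ dₛ ∅ₛ : Schema
  _&ₛ_ _⇒ₛ_ _∩ₛ_ : Schema → Schema → Schema

⟦_⟧ : Schema → Obj → Obj → Obj → Obj → Obj
⟦ aₛ ⟧      A B C D = A
⟦ bₛ ⟧      A B C D = B
⟦ cₛ ⟧      A B C D = C
⟦ dₛ ⟧      A B C D = D
⟦ ∅ₛ ⟧      A B C D = ∅
⟦ S &ₛ T ⟧  A B C D = ⟦ S ⟧ A B C D & ⟦ T ⟧ A B C D
⟦ S ⇒ₛ T ⟧  A B C D = ⟦ S ⟧ A B C D ⇒ ⟦ T ⟧ A B C D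
⟦ S ∩ₛ T ⟧  A B C D = ⟦ S ⟧ A B C D ∩ ⟦ T ⟧ A B C D

replace-⟦⟧ : ∀ S x u {A B C D} →
  replace x u (⟦ S ⟧ A B C D) ≡ ⟦ S ⟧ (replace x u A) (replace x u B) (replace x u C) (replace x u D)
replace-⟦⟧ aₛ       x u = refl
replace-⟦⟧ bₛ       x u = refl
replace-⟦⟧ cₛ       x u = refl
replace-⟦⟧ dₛ       x u = refl
replace-⟦⟧ ∅ₛ       x u = refl
replace-⟦⟧ (S &ₛ T) x u = cong₂ _&_ (replace-⟦⟧ S x u) (replace-⟦⟧ T x u)
replace-⟦⟧ (S ⇒ₛ T) x u = cong₂ _⇒_ (replace-⟦⟧ S x u) (replace-⟦⟧ T x u)
replace-⟦⟧ (S ∩ₛ T) x u = cong₂ _∩_ (replace-⟦⟧ S x u) (replace-⟦⟧ T x u)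

substitute : ∀ S x u {A B C D} → ⊢ ⟦ S ⟧ A B C D →
  ⊢ ⟦ S ⟧ (replace x u A) (replace x u B) (replace x u C) (replace x u D)
substitute S x u p = subst ⊢_ (replace-⟦⟧ S x u) (R2 x u p)

retype : ∀ S {A B C D A' B' C' D'} → A ≡ A' → B ≡ B' → C ≡ C' → D ≡ D' →
  ⊢ ⟦ S ⟧ A B C D → ⊢ ⟦ S ⟧ A' B' C' D'
retype S refl refl refl refl p = p

tower : ℕ → Obj
tower zero    = ∅
tower (suc m) = tower m ᶜ

rank : ∀ {n} → Tm n → ℕ
rank ∅        = 0
rank (ix i)   = 0
rank (var s)  = rank s
rank (t ᶜ)    = suc (rank t)
rank (t & u)  = rank t ⊔ rank u
rank (t ⇒ u)  = rank t ⊔ rank u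
rank (t ∩ u)  = rank t ⊔ rank u
rank (cls t)  = rank t

rank-tower : ∀ m → rank (tower m) ≡ m
rank-tower zero    = refl
rank-tower (suc m) = cong suc (rank-tower m)

tower-same : ∀ m → eqTm (tower m) (tower m) ≡ true
tower-same zero    = refl
tower-same (suc m) = tower-same m

tower-fresh : ∀ (s : Obj) {m} → rank s < m → eqTm s (tower m) ≡ false
tower-fresh ∅       {suc m} r = refl
tower-fresh (var s) {suc m} r = refl
tower-fresh (s ᶜ)   {suc m} r = tower-fresh s (s<s⁻¹ r)
tower-fresh (s & t) {suc m} r = refl
tower-fresh (s ⇒ t) {suc m} r = refl
tower-fresh (s ∩ t) {suc m} r = refl
tower-fresh (cls s) {suc m} r = refl

replace-low : ∀ {n} (t : Tm n) {m} (u : Tm n) → rank t < m → replace (tower m) u t ≡ t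
replace-low ∅       u r = refl
replace-low (ix i)  u r = refl
replace-low (var s) u r rewrite tower-fresh s r = refl
replace-low (t ᶜ)   u r = cong _ᶜ (replace-low t u (<-trans (n<1+n (rank t)) r))
replace-low (t & v) u r = cong₂ _&_ (replace-low t u (m⊔n<o⇒m<o _ _ r)) (replace-low v u (m⊔n<o⇒n<o _ _ r))
replace-low (t ⇒ v) u r = cong₂ _⇒_ (replace-low t u (m⊔n<o⇒m<o _ _ r)) (replace-low v u (m⊔n<o⇒n<o _ _ r))
replace-low (t ∩ v) u r = cong₂ _∩_ (replace-low t u (m⊔n<o⇒m<o _ _ r)) (replace-low v u (m⊔n<o⇒n<o _ _ r))
replace-low (cls t) u r = cong cls (replace-low t (wk u) r)

replace-tower : ∀ {n} m (u : Tm n) → replace (tower m) u (var (tower m)) ≡ u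
replace-tower m u rewrite tower-same m = refl

instantiate : ∀ S A B C D → ⊢ ⟦ S ⟧ a b c d → ⊢ ⟦ S ⟧ A B C D
instantiate S A B C D axiom = fill-d (fill-c (fill-b (fill-a (rename-to-guards axiom))))
  where
  n : ℕ
  n = rank (A & B & C & D)

  guard : ℕ → Obj
  guard j = var (tower (j + suc n))

  below : ∀ j → n < j + suc n
  below j = m≤n+m (suc n) j

  A< : ∀ j → rank A < j + suc n
  A< j = m⊔n<o⇒m<o (rank A) _ (below j)
  B< : ∀ j → rank B < j + suc n
  B< j = m⊔n<o⇒m<o (rank B) _ (m⊔n<o⇒n<o (rank A) _ (below j))
  C< : ∀ j → rank C < j + suc n
  C< j = m⊔n<o⇒m<o (rank C) _ (m⊔n<o⇒n<o (rank B) _ (m⊔n<o⇒n<o (rank A) _ (below j)))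

  guard< : ∀ i j → i < j → rank (guard i) < j + suc n
  guard< i j i<j = subst (_< j + suc n) (sym (rank-tower (i + suc n))) (+-monoˡ-< (suc n) i<j)

  -- renaming pass: a, b, c, d become guards 3, 2, 1, 0; every step
  -- computes, as the names involved are distinct closed objects
  rename-to-guards : ⊢ ⟦ S ⟧ a b c d → ⊢ ⟦ S ⟧ (guard 3) (guard 2) (guard 1) (guard 0)
  rename-to-guards p =
    substitute S nd (guard 0) (substitute S nc (guard 1) (substitute S nb (guard 2) (substitute S na (guard 3) p)))

  -- filling pass, highest guard first: the guards still present are lower
  -- and the objects already inserted have rank at most n
  fill-a : ⊢ ⟦ S ⟧ (guard 3) (guard 2) (guard 1) (guard 0) → ⊢ ⟦ S ⟧ A (guard 2) (guard 1) (guard 0)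
  fill-a p = retype S (replace-tower _ A) (replace-low (guard 2) A (guard< 2 3 (s<s (s<s z<s))))
               (replace-low (guard 1) A (guard< 1 3 (s<s z<s))) (replace-low (guard 0) A (guard< 0 3 z<s))
               (substitute S (tower (3 + suc n)) A p)

  fill-b : ⊢ ⟦ S ⟧ A (guard 2) (guard 1) (guard 0) → ⊢ ⟦ S ⟧ A B (guard 1) (guard 0)
  fill-b p = retype S (replace-low A B (A< 2)) (replace-tower _ B)
               (replace-low (guard 1) B (guard< 1 2 (s<s z<s))) (replace-low (guard 0) B (guard< 0 2 z<s))
               (substitute S (tower (2 + suc n)) B p)

  fill-c : ⊢ ⟦ S ⟧ A B (guard 1) (guard 0) → ⊢ ⟦ S ⟧ A B C (guard 0)
  fill-c p = retype S (replace-low A C (A< 1)) (replace-low B C (B< 1)) (replace-tower _ C)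
               (replace-low (guard 0) C (guard< 0 1 z<s))
               (substitute S (tower (1 + suc n)) C p)

  fill-d : ⊢ ⟦ S ⟧ A B C (guard 0) → ⊢ ⟦ S ⟧ A B C D
  fill-d p = retype S (replace-low A D (A< 0)) (replace-low B D (B< 0)) (replace-low C D (C< 0))
               (replace-tower _ D)
               (substitute S (tower (0 + suc n)) D p)

mp-ax : ∀ C A B → ⊢ ((C ⇒ A) & (C ⇒ (A ⇒ B))) ⇒ (C ⇒ B)
mp-ax C A B = instantiate (((cₛ ⇒ₛ aₛ) &ₛ (cₛ ⇒ₛ (aₛ ⇒ₛ bₛ))) ⇒ₛ (cₛ ⇒ₛ bₛ)) A B C ∅ A1

chain-ax : ∀ D A B C → ⊢ ((D ⇒ (A ⇒ B)) & (D ⇒ (B ⇒ C))) ⇒ (D ⇒ (A ⇒ C))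
chain-ax D A B C =
  instantiate (((dₛ ⇒ₛ (aₛ ⇒ₛ bₛ)) &ₛ (dₛ ⇒ₛ (bₛ ⇒ₛ cₛ))) ⇒ₛ (dₛ ⇒ₛ (aₛ ⇒ₛ cₛ))) A B C D A2

pair-ax : ∀ C A B → ⊢ ((C ⇒ A) & (C ⇒ B)) ⇒ (C ⇒ (A & B))
pair-ax C A B = instantiate (((cₛ ⇒ₛ aₛ) &ₛ (cₛ ⇒ₛ bₛ)) ⇒ₛ (cₛ ⇒ₛ (aₛ &ₛ bₛ))) A B C ∅ A3

fst-ax : ∀ A B → ⊢ (A & B) ⇒ A
fst-ax A B = instantiate ((aₛ &ₛ bₛ) ⇒ₛ aₛ) A B ∅ ∅ A4l

snd-ax : ∀ A B → ⊢ (A & B) ⇒ B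
snd-ax A B = instantiate ((aₛ &ₛ bₛ) ⇒ₛ bₛ) A B ∅ ∅ A4r

inl-ax : ∀ A B → ⊢ A ⇒ (A ∩ B)
inl-ax A B = instantiate (aₛ ⇒ₛ (aₛ ∩ₛ bₛ)) A B ∅ ∅ A5l

inr-ax : ∀ A B → ⊢ B ⇒ (A ∩ B)
inr-ax A B = instantiate (bₛ ⇒ₛ (aₛ ∩ₛ bₛ)) A B ∅ ∅ A5r

case-ax : ∀ A B C → ⊢ ((A ⇒ C) & (B ⇒ C)) ⇒ ((A ∩ B) ⇒ C)
case-ax A B C = instantiate (((aₛ ⇒ₛ cₛ) &ₛ (bₛ ⇒ₛ cₛ)) ⇒ₛ ((aₛ ∩ₛ bₛ) ⇒ₛ cₛ)) A B C ∅ A6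

refl-ax : ∀ A → ⊢ A ⇒ A
refl-ax A = R2 na A A7

true-ax : ∀ A → ⊢ A ⇒ ∅
true-ax A = R2 na A A8

ex-falso : ∀ A → ⊢ bot ⇒ A
ex-falso A = R2 na A A9

box-pair-ax : ∀ A B → ⊢ (∅ ⇒ A) ⇒ ((∅ ⇒ B) ⇒ (A & B))
box-pair-ax A B = instantiate ((∅ₛ ⇒ₛ aₛ) ⇒ₛ ((∅ₛ ⇒ₛ bₛ) ⇒ₛ (aₛ &ₛ bₛ))) A B ∅ ∅ A10

box-imp-ax : ∀ A B → ⊢ (A ⇒ B) ⇒ (∅ ⇒ (A ⇒ B))
box-imp-ax A B = instantiate ((aₛ ⇒ₛ bₛ) ⇒ₛ (∅ₛ ⇒ₛ (aₛ ⇒ₛ bₛ))) A B ∅ ∅ A11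

∅-true : ⊢ ∅
∅-true = R1 (refl-ax ∅) (true-ax (∅ ⇒ ∅))

unbox : ∀ {X} → ⊢ ∅ ⇒ X → ⊢ X
unbox p = R1 ∅-true p

-- Provable implications are necessary (A11), and necessary objects can be
-- conjoined (A10); this turns the axioms A1-A6 into rules.
necessitate : ∀ {A B} → ⊢ A ⇒ B → ⊢ ∅ ⇒ (A ⇒ B)
necessitate {A} {B} p = R1 p (box-imp-ax A B)

both : ∀ {P Q R S} → ⊢ P ⇒ Q → ⊢ R ⇒ S → ⊢ (P ⇒ Q) & (R ⇒ S)
both {P} {Q} {R} {S} p q = R1 (necessitate q) (R1 (necessitate p) (box-pair-ax (P ⇒ Q) (R ⇒ S)))

mp : ∀ {C A B} → ⊢ C ⇒ A → ⊢ C ⇒ (A ⇒ B) → ⊢ C ⇒ B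
mp {C} {A} {B} p q = R1 (both p q) (mp-ax C A B)

chain : ∀ {D A B C} → ⊢ D ⇒ (A ⇒ B) → ⊢ D ⇒ (B ⇒ C) → ⊢ D ⇒ (A ⇒ C)
chain {D} {A} {B} {C} p q = R1 (both p q) (chain-ax D A B C)

pair : ∀ {C A B} → ⊢ C ⇒ A → ⊢ C ⇒ B → ⊢ C ⇒ (A & B)
pair {C} {A} {B} p q = R1 (both p q) (pair-ax C A B)

infixr 9 _∙_
_∙_ : ∀ {P Q R} → ⊢ P ⇒ Q → ⊢ Q ⇒ R → ⊢ P ⇒ R
p ∙ q = unbox (chain (necessitate p) (necessitate q))

weaken : ∀ {A B} C → ⊢ A ⇒ B → ⊢ C ⇒ (A ⇒ B)
weaken C p = true-ax C ∙ necessitate p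

pair-under : ∀ {G P Q R} → ⊢ G ⇒ (P ⇒ Q) → ⊢ G ⇒ (P ⇒ R) → ⊢ G ⇒ (P ⇒ (Q & R))
pair-under {G} {P} {Q} {R} p q = mp (pair p q) (weaken G (pair-ax P Q R))

box-elim : ∀ X → ⊢ (∅ ⇒ X) ⇒ X
box-elim X = mp (true-ax (∅ ⇒ X)) (refl-ax (∅ ⇒ X))

Persistent : Obj → Set
Persistent Q = ∀ P → ⊢ Q ⇒ (P ⇒ Q)

-- Implications are persistent: they are necessary (A11), and a necessary
-- object follows from anything because anything implies ∅.
implication-persistent : ∀ A B → Persistent (A ⇒ B)
implication-persistent A B P =
  box-imp-ax A B ∙ chain (weaken (∅ ⇒ (A ⇒ B)) (true-ax P)) (refl-ax (∅ ⇒ (A ⇒ B)))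

&-persistent : ∀ {Q R} → Persistent Q → Persistent R → Persistent (Q & R)
&-persistent {Q} {R} q r P =
  pair-under (mp (fst-ax Q R) (weaken (Q & R) (q P))) (mp (snd-ax Q R) (weaken (Q & R) (r P)))

deduction : ∀ {G X R} → Persistent G → ⊢ (X & G) ⇒ R → ⊢ G ⇒ (X ⇒ R)
deduction {G} {X} g r = chain (pair-under (weaken G (refl-ax X)) (g X)) (weaken G r)

&-mono : ∀ {G P P' Q Q'} → ⊢ G ⇒ (P ⇒ P') → ⊢ G ⇒ (Q ⇒ Q') → ⊢ G ⇒ ((P & Q) ⇒ (P' & Q'))
&-mono {G} {P} {P'} {Q} {Q'} p q =
  pair-under (chain (weaken G (fst-ax P Q)) p) (chain (weaken G (snd-ax P Q)) q)

∩-mono : ∀ {G P P' Q Q'} → ⊢ G ⇒ (P ⇒ P') → ⊢ G ⇒ (Q ⇒ Q') → ⊢ G ⇒ ((P ∩ Q) ⇒ (P' ∩ Q'))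
∩-mono {G} {P} {P'} {Q} {Q'} p q =
  mp (pair (chain p (weaken G (inl-ax P' Q'))) (chain q (weaken G (inr-ax P' Q'))))
     (weaken G (case-ax P Q (P' ∩ Q')))

⇒-mono : ∀ {G P P' Q Q'} → Persistent G →
  ⊢ G ⇒ (P' ⇒ P) → ⊢ G ⇒ (Q ⇒ Q') → ⊢ G ⇒ ((P ⇒ Q) ⇒ (P' ⇒ Q'))
⇒-mono {G} {P} {P'} {Q} {Q'} g p q =
  deduction g (chain (chain (snd-ax (P ⇒ Q) G ∙ p) (fst-ax (P ⇒ Q) G)) (snd-ax (P ⇒ Q) G ∙ q))

infixr 4 _⇒ₖ_
infixr 5 _&ₖ_
infixr 6 _∩ₖ_

data Ctx : Set where
  □ : Ctx
  const : Obj → Ctx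
  _&ₖ_ _⇒ₖ_ _∩ₖ_ : Ctx → Ctx → Ctx

plug : Ctx → Obj → Obj
plug □         t = t
plug (const s) t = s
plug (K &ₖ L)  t = plug K t & plug L t
plug (K ⇒ₖ L)  t = plug K t ⇒ plug L t
plug (K ∩ₖ L)  t = plug K t ∩ plug L t

-- If G is persistent and makes A and B equivalent, then every context maps
-- A into B (the two directions are needed together for the premise of ⇒).
congruence : ∀ K {G A B} → Persistent G →
  ⊢ G ⇒ (A ⇒ B) → ⊢ G ⇒ (B ⇒ A) → ⊢ G ⇒ (plug K A ⇒ plug K B)
congruence □         g p q = p
congruence (const s) {G} g p q = weaken G (refl-ax s)
congruence (K &ₖ L)  g p q = &-mono (congruence K g p q) (congruence L g p q)
congruence (K ⇒ₖ L)  g p q = ⇒-mono g (congruence K g q p) (congruence L g p q)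
congruence (K ∩ₖ L)  g p q = ∩-mono (congruence K g p q) (congruence L g p q)

≐-congruence : ∀ K A B → ⊢ (A ≐ B) ⇒ (plug K A ≐ plug K B)
≐-congruence K A B = pair (congruence K persistent (fst-ax (A ⇒ B) (B ⇒ A)) (snd-ax (A ⇒ B) (B ⇒ A)))
                          (congruence K persistent (snd-ax (A ⇒ B) (B ⇒ A)) (fst-ax (A ⇒ B) (B ⇒ A)))
  where
  persistent : Persistent (A ≐ B)
  persistent = &-persistent (implication-persistent A B) (implication-persistent B A)

Sing-ctx : Ctx
Sing-ctx = negₖ (barₖ □ ≐ₖ □) &ₖ ((□ ⇒ₖ y) ⇒ₖ (barₖ y ∨ₖ (□ ≐ₖ y)))
  where
  barₖ negₖ : Ctx → Ctx
  barₖ K = const ∅ ⇒ₖ K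
  negₖ K = K ⇒ₖ const bot
  _≐ₖ_ _∨ₖ_ : Ctx → Ctx → Ctx
  K ≐ₖ L = (K ⇒ₖ L) &ₖ (L ⇒ₖ K)
  K ∨ₖ L = barₖ (barₖ K ∩ₖ barₖ L)
  y : Ctx
  y = const (var nSing)

-- An object that implies its own necessitation is not single: the first
-- conjunct of Sing(t) denies t̄ = t, yet t̄ ⇒ t always holds.
not-single : ∀ t → ⊢ t ⇒ bar t → ⊢ neg (Sing t)
not-single t t⇒t̄ = mp (pair (weaken (Sing t) (box-elim t)) (weaken (Sing t) t⇒t̄))
                      (fst-ax (bar t ≠ₒ t) _)

proposition3p4 : (⊢ (a ≐ b) ⇒ (Sing a ≐ Sing b)) × (⊢ neg (Sing ∅)) × (⊢ neg (Sing bot))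
proposition3p4 =
  ≐-congruence Sing-ctx a b ,
  not-single ∅ (necessitate (refl-ax ∅)) ,
  not-single bot (ex-falso (bar bot))
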